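{- Let $E$ be a low-defect expression and $x,y$ variables of $E$. Then $x\preceq y$ in the nesting ordering if and only if the key of $y$ divides the key of $x$, and this holds if and only if the anti-key of $y$ divides the anti-key of $x$ (divisibility of monomials, ignoring coefficients).
   Context: Low-defect expressions: (a) every positive integer constant is one; (b) the product of two low-defect expressions with disjoint variable sets is one; (c) if $E$ is one, $c$ a positive integer and $x$ a variable not in $E$, then $E\cdot x+c$ is one. Nesting ordering: $x\preceq y$ iff $x$ appears in the smallest low-defect subexpression of $E$ containing $y$. The low-defect tree $T$ of $E$: for a constant $n$, a single vertex labeled $n$; for $E=E'\cdot x+c$ with tree $T'$, $T'$ with a new root labeled $1$ joined to the root of $T'$ by an edge labeled $c$; for $E=E_1\cdot E_2$ with trees $T_1,T_2$, remove both roots and add a new root labeled by the product of the old root labels, adjacent to all vertices formerly adjacent to either old root. Variables correspond bijectively to non-root vertices: for $E=E'\cdot x+c$, variables of $E'$ correspond as in $T'$ and $x$ to the root of $T'$; for $E=E_1\cdot E_2$, as in $T_1$, $T_2$. Write $v_z$ for the vertex of variable $z$ and $x_v$ for the variable of vertex $v$. Key and anti-key: the key of a variable $x$ is the monomial $\prod x_v$ over all non-root vertices $v$ that are ancestors of $v_x$ (including $v_x$ itself); the anti-key of $x$ is the monomial $\prod x_v$ over all non-root vertices $v$ that are not descendants of $v_x$ (where $v_x$ counts as its own descendant). Both are monomials occurring in the low-defect polynomial of $E$. -}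

module Defs where

open import Data.Nat using (ℕ; suc; _*_; _≤_; _≟_)
open import Data.List using (List; []; _∷_; [_]; _++_; filter)
open import Data.List.Membership.Propositional using (_∈_; _∉_)
open import Data.List.Membership.DecPropositional (_≟_) using (_∈?_)
open import Data.Maybe using (Maybe; just; nothing; fromMaybe)
open import Data.Product using (Σ; _×_)
open import Relation.Nullary using (¬?; yes; no)
open import Relation.Binary.PropositionalEquality using (_≡_)

Var : Set
Var = ℕ

data Expr : Set where
  const : ℕ → Expr
  mul   : Expr → Expr → Expr
  lin   : Expr → Var → ℕ → Expr   -- lin E x c  represents  E · x + c

vars : Expr → List Var
vars (const n)   = []
vars (mul E₁ E₂) = vars E₁ ++ vars E₂
vars (lin E x c) = vars E ++ [ x ]

data LowDefect : Expr → Set where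
  ld-const : ∀ {n} → 1 ≤ n → LowDefect (const n)
  ld-mul   : ∀ {E₁ E₂} → LowDefect E₁ → LowDefect E₂ →
             (∀ v → v ∈ vars E₁ → v ∉ vars E₂) → LowDefect (mul E₁ E₂)
  ld-lin   : ∀ {E x c} → LowDefect E → x ∉ vars E → 1 ≤ c → LowDefect (lin E x c)

data _⊑_ : Expr → Expr → Set where
  ⊑-refl : ∀ {E} → E ⊑ E
  ⊑-mulˡ : ∀ {S E₁ E₂} → S ⊑ E₁ → S ⊑ mul E₁ E₂
  ⊑-mulʳ : ∀ {S E₁ E₂} → S ⊑ E₂ → S ⊑ mul E₁ E₂
  ⊑-lin  : ∀ {S E x c} → S ⊑ E → S ⊑ lin E x c

Smallest : Expr → Var → Expr → Set
Smallest S y E = (S ⊑ E) × (y ∈ vars S) × (∀ S′ → S′ ⊑ E → y ∈ vars S′ → S ⊑ S′)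

_⪯[_]_ : Var → Expr → Var → Set
x ⪯[ E ] y = Σ Expr (λ S → Smallest S y E × x ∈ vars S)

-- Low-defect trees: a vertex label and a list of children; each child carries
-- the label of the edge to it and the variable of the child vertex.
mutual
  data Tree : Set where
    node : ℕ → List Child → Tree

  data Child : Set where
    child : ℕ → Var → Tree → Child

tree : Expr → Tree
tree (const n) = node n []
tree (lin E x c) = node 1 [ child c x (tree E) ]
tree (mul E₁ E₂) with tree E₁ | tree E₂
... | node n₁ cs₁ | node n₂ cs₂ = node (n₁ * n₂) (cs₁ ++ cs₂)

mutual
  treeVars : Tree → List Var
  treeVars (node n cs) = childrenVars cs

  childrenVars : List Child → List Var
  childrenVars [] = []
  childrenVars (child c z t ∷ cs) = z ∷ treeVars t ++ childrenVars cs

mutual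
  path : Var → Tree → Maybe (List Var)
  path x (node n cs) = pathCs x cs

  pathCs : Var → List Child → Maybe (List Var)
  pathCs x [] = nothing
  pathCs x (child c z t ∷ cs) with x ≟ z
  ... | yes _ = just [ z ]
  ... | no _ with path x t
  ...   | just p  = just (z ∷ p)
  ...   | nothing = pathCs x cs

mutual
  descendants : Var → Tree → Maybe (List Var)
  descendants x (node n cs) = descCs x cs

  descCs : Var → List Child → Maybe (List Var)
  descCs x [] = nothing
  descCs x (child c z t ∷ cs) with x ≟ z
  ... | yes _ = just (z ∷ treeVars t)
  ... | no _ with descendants x t
  ...   | just d  = just d
  ...   | nothing = descCs x cs

-- Monomials (coefficients ignored): exponent vectors.
Monomial : Set
Monomial = Var → ℕ

monomial : List Var → Monomial
monomial [] v = 0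
monomial (w ∷ ws) v with v ≟ w
... | yes _ = suc (monomial ws v)
... | no _  = monomial ws v

_∣ₘ_ : Monomial → Monomial → Set
m ∣ₘ n = ∀ v → m v ≤ n v

key : Expr → Var → Monomial
key E x = monomial (fromMaybe [] (path x (tree E)))

antiKey : Expr → Var → Monomial
antiKey E x =
  monomial (filter (λ v → ¬? (v ∈? fromMaybe [] (descendants x (tree E)))) (treeVars (tree E)))

-- All three conditions are equivalent to v_y being an ancestor of v_x in the
-- low-defect tree.  The smallest subexpression containing y is the one in
-- which y was introduced by rule (c); its variables are exactly those of the
-- subtree rooted at v_y.  The key of x is the list of vertices on the path
-- from the root to v_x, so key y divides key x iff the path to v_y is a prefix
-- of the path to v_x.  The anti-key of x is the complement of the subtree of
-- v_x, so anti-key y divides anti-key x iff the subtree of v_x is contained in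
-- the subtree of v_y.  Each step uses that the factors of a product have
-- disjoint variables, so that a variable lies in exactly one branch.

module Submission where

open import Defs
open import Data.List.Membership.Propositional using (_∈_)
open import Data.Product using (_×_)
open import Function.Bundles using (_⇔_)

open import Data.Nat using (_≤_; z≤n; s≤s; _≟_)
open import Data.Nat.Properties using (≤-trans; m≤n⇒m≤1+n)
open import Data.List using (List; []; _∷_; [_]; _++_; filter)
open import Data.List.Properties using (++-assoc; ++-identityʳ)
open import Data.List.Membership.Propositional using (_∉_)
open import Data.List.Membership.DecPropositional (_≟_) using (_∈?_)
open import Data.List.Membership.Propositional.Properties using (∈-++⁺ˡ; ∈-++⁺ʳ; ∈-++⁻; ∈-filter⁺; ∈-filter⁻)
open import Data.List.Relation.Binary.Subset.Propositional using (_⊆_)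
open import Data.List.Relation.Unary.Any using (here; there)
open import Data.Maybe using (just; nothing; fromMaybe; _<∣>_)
open import Data.Product using (_,_; proj₂; ∃)
open import Data.Sum using (inj₁; inj₂)
open import Data.Empty using (⊥-elim)
open import Relation.Nullary using (¬_; ¬?; Dec; yes; no)
open import Relation.Unary using (Pred; Decidable)
open import Relation.Binary.PropositionalEquality using (_≡_; refl; sym; cong)
open import Function.Bundles using (mk⇔)
import Function.Properties.Equivalence as ⇔

∈⇒monomial-pos : ∀ {ws : List Var} {v} → v ∈ ws → 1 ≤ monomial ws v
∈⇒monomial-pos {w ∷ ws} {v} v∈ with v ≟ w | v∈
... | yes _   | _         = s≤s z≤n
... | no v≢w  | here v≡w  = ⊥-elim (v≢w v≡w)
... | no _    | there v∈′ = ∈⇒monomial-pos v∈′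

monomial-pos⇒∈ : ∀ (ws : List Var) {v} → 1 ≤ monomial ws v → v ∈ ws
monomial-pos⇒∈ (w ∷ ws) {v} pos with v ≟ w
... | yes v≡w = here v≡w
... | no _    = there (monomial-pos⇒∈ ws pos)

∣ₘ⇒⊆ : ∀ (us ws : List Var) → monomial us ∣ₘ monomial ws → us ⊆ ws
∣ₘ⇒⊆ us ws us∣ws {v} v∈ = monomial-pos⇒∈ ws (≤-trans (∈⇒monomial-pos v∈) (us∣ws v))

monomial-++ˡ : ∀ (ws us : List Var) → monomial ws ∣ₘ monomial (ws ++ us)
monomial-++ˡ []       us v = z≤n
monomial-++ˡ (w ∷ ws) us v with v ≟ w
... | yes _ = s≤s (monomial-++ˡ ws us v)
... | no _  = monomial-++ˡ ws us v

monomial-filter-mono : ∀ {p q} {P : Pred Var p} {Q : Pred Var q} (P? : Decidable P) (Q? : Decidable Q) →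
                       (∀ {w} → P w → Q w) → ∀ ws → monomial (filter P? ws) ∣ₘ monomial (filter Q? ws)
monomial-filter-mono P? Q? P⇒Q [] v = z≤n
monomial-filter-mono P? Q? P⇒Q (w ∷ ws) v with P? w | Q? w
... | yes Pw | no ¬Qw = ⊥-elim (¬Qw (P⇒Q Pw))
... | yes _  | yes _ with v ≟ w
...   | yes _ = s≤s (monomial-filter-mono P? Q? P⇒Q ws v)
...   | no _  = monomial-filter-mono P? Q? P⇒Q ws v
monomial-filter-mono P? Q? P⇒Q (w ∷ ws) v | no _ | yes _ with v ≟ w
...   | yes _ = m≤n⇒m≤1+n (monomial-filter-mono P? Q? P⇒Q ws v)
...   | no _  = monomial-filter-mono P? Q? P⇒Q ws v
monomial-filter-mono P? Q? P⇒Q (w ∷ ws) v | no _ | no _ = monomial-filter-mono P? Q? P⇒Q ws v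

∈-++-∉ˡ : ∀ {A : Set} (xs : List A) {ys x} → x ∈ xs ++ ys → x ∉ xs → x ∈ ys
∈-++-∉ˡ xs x∈ x∉xs with ∈-++⁻ xs x∈
... | inj₁ x∈xs = ⊥-elim (x∉xs x∈xs)
... | inj₂ x∈ys = x∈ys

∈-∷ʳ-≢ : ∀ {A : Set} (xs : List A) {x z} → x ∈ xs ++ [ z ] → ¬ x ≡ z → x ∈ xs
∈-∷ʳ-≢ xs x∈ x≢z with ∈-++⁻ xs x∈
... | inj₁ x∈xs        = x∈xs
... | inj₂ (here x≡z)  = ⊥-elim (x≢z x≡z)

lin-var : ∀ E z c → z ∈ vars (lin E z c)
lin-var E z c = ∈-++⁺ʳ (vars E) (here refl)

childrenVars-++ : ∀ cs₁ cs₂ → childrenVars (cs₁ ++ cs₂) ≡ childrenVars cs₁ ++ childrenVars cs₂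
childrenVars-++ []                   cs₂ = refl
childrenVars-++ (child c z t ∷ cs₁) cs₂ rewrite childrenVars-++ cs₁ cs₂ =
  cong (z ∷_) (sym (++-assoc (treeVars t) (childrenVars cs₁) (childrenVars cs₂)))

pathCs-++ : ∀ x cs₁ cs₂ → pathCs x (cs₁ ++ cs₂) ≡ (pathCs x cs₁ <∣> pathCs x cs₂)
pathCs-++ x []                   cs₂ = refl
pathCs-++ x (child c z t ∷ cs₁) cs₂ with x ≟ z
... | yes _ = refl
... | no _ with path x t
...   | just _  = refl
...   | nothing = pathCs-++ x cs₁ cs₂

descCs-++ : ∀ x cs₁ cs₂ → descCs x (cs₁ ++ cs₂) ≡ (descCs x cs₁ <∣> descCs x cs₂)
descCs-++ x []                   cs₂ = refl
descCs-++ x (child c z t ∷ cs₁) cs₂ with x ≟ z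
... | yes _ = refl
... | no _ with descendants x t
...   | just _  = refl
...   | nothing = descCs-++ x cs₁ cs₂

treeVars-mul : ∀ E₁ E₂ → treeVars (tree (mul E₁ E₂)) ≡ treeVars (tree E₁) ++ treeVars (tree E₂)
treeVars-mul E₁ E₂ with tree E₁ | tree E₂
... | node _ cs₁ | node _ cs₂ = childrenVars-++ cs₁ cs₂

path-mul : ∀ E₁ E₂ x → path x (tree (mul E₁ E₂)) ≡ (path x (tree E₁) <∣> path x (tree E₂))
path-mul E₁ E₂ x with tree E₁ | tree E₂
... | node _ cs₁ | node _ cs₂ = pathCs-++ x cs₁ cs₂

descendants-mul : ∀ E₁ E₂ x → descendants x (tree (mul E₁ E₂)) ≡ (descendants x (tree E₁) <∣> descendants x (tree E₂))
descendants-mul E₁ E₂ x with tree E₁ | tree E₂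
... | node _ cs₁ | node _ cs₂ = descCs-++ x cs₁ cs₂

treeVars⊆vars : ∀ E → treeVars (tree E) ⊆ vars E
treeVars⊆vars (const n) ()
treeVars⊆vars (mul E₁ E₂) v∈ rewrite treeVars-mul E₁ E₂ with ∈-++⁻ (treeVars (tree E₁)) v∈
... | inj₁ v∈₁ = ∈-++⁺ˡ (treeVars⊆vars E₁ v∈₁)
... | inj₂ v∈₂ = ∈-++⁺ʳ (vars E₁) (treeVars⊆vars E₂ v∈₂)
treeVars⊆vars (lin E z c) (here refl) = lin-var E z c
treeVars⊆vars (lin E z c) (there v∈) with ∈-++⁻ (treeVars (tree E)) v∈
... | inj₁ v∈E = ∈-++⁺ˡ (treeVars⊆vars E v∈E)
... | inj₂ ()

vars⊆treeVars : ∀ E → vars E ⊆ treeVars (tree E)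
vars⊆treeVars (const n) ()
vars⊆treeVars (mul E₁ E₂) v∈ rewrite treeVars-mul E₁ E₂ with ∈-++⁻ (vars E₁) v∈
... | inj₁ v∈₁ = ∈-++⁺ˡ (vars⊆treeVars E₁ v∈₁)
... | inj₂ v∈₂ = ∈-++⁺ʳ (treeVars (tree E₁)) (vars⊆treeVars E₂ v∈₂)
vars⊆treeVars (lin E z c) v∈ with ∈-++⁻ (vars E) v∈
... | inj₁ v∈E        = there (∈-++⁺ˡ (vars⊆treeVars E v∈E))
... | inj₂ (here refl) = here refl

path-∉ : ∀ E {x} → x ∉ vars E → path x (tree E) ≡ nothing
path-∉ (const n) x∉ = refl
path-∉ (mul E₁ E₂) {x} x∉ rewrite path-mul E₁ E₂ x | path-∉ E₁ (λ x∈ → x∉ (∈-++⁺ˡ x∈)) =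
  path-∉ E₂ (λ x∈ → x∉ (∈-++⁺ʳ (vars E₁) x∈))
path-∉ (lin E z c) {x} x∉ with x ≟ z
... | yes refl = ⊥-elim (x∉ (lin-var E z c))
... | no _ rewrite path-∉ E (λ x∈ → x∉ (∈-++⁺ˡ x∈)) = refl

path-∈ : ∀ E {x} → x ∈ vars E → ∃ λ p → path x (tree E) ≡ just p
path-∈ (const n) ()
path-∈ (mul E₁ E₂) {x} x∈ rewrite path-mul E₁ E₂ x with x ∈? vars E₁
... | yes x∈₁ rewrite proj₂ (path-∈ E₁ x∈₁) = _ , refl
... | no x∉₁ rewrite path-∉ E₁ x∉₁ = path-∈ E₂ (∈-++-∉ˡ (vars E₁) x∈ x∉₁)
path-∈ (lin E z c) {x} x∈ with x ≟ z
... | yes _   = _ , refl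
... | no x≢z rewrite proj₂ (path-∈ E (∈-∷ʳ-≢ (vars E) x∈ x≢z)) = _ , refl

descendants-∉ : ∀ E {x} → x ∉ vars E → descendants x (tree E) ≡ nothing
descendants-∉ (const n) x∉ = refl
descendants-∉ (mul E₁ E₂) {x} x∉ rewrite descendants-mul E₁ E₂ x | descendants-∉ E₁ (λ x∈ → x∉ (∈-++⁺ˡ x∈)) =
  descendants-∉ E₂ (λ x∈ → x∉ (∈-++⁺ʳ (vars E₁) x∈))
descendants-∉ (lin E z c) {x} x∉ with x ≟ z
... | yes refl = ⊥-elim (x∉ (lin-var E z c))
... | no _ rewrite descendants-∉ E (λ x∈ → x∉ (∈-++⁺ˡ x∈)) = refl

descendants-∈ : ∀ E {x} → x ∈ vars E → ∃ λ d → descendants x (tree E) ≡ just d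
descendants-∈ (const n) ()
descendants-∈ (mul E₁ E₂) {x} x∈ rewrite descendants-mul E₁ E₂ x with x ∈? vars E₁
... | yes x∈₁ rewrite proj₂ (descendants-∈ E₁ x∈₁) = _ , refl
... | no x∉₁ rewrite descendants-∉ E₁ x∉₁ = descendants-∈ E₂ (∈-++-∉ˡ (vars E₁) x∈ x∉₁)
descendants-∈ (lin E z c) {x} x∈ with x ≟ z
... | yes _   = _ , refl
... | no x≢z rewrite proj₂ (descendants-∈ E (∈-∷ʳ-≢ (vars E) x∈ x≢z)) = _ , refl

pathOf : Expr → Var → List Var
pathOf E x = fromMaybe [] (path x (tree E))

descendantsOf : Expr → Var → List Var
descendantsOf E x = fromMaybe [] (descendants x (tree E))

pathOf-mulˡ : ∀ E₁ E₂ {x} → x ∈ vars E₁ → pathOf (mul E₁ E₂) x ≡ pathOf E₁ x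
pathOf-mulˡ E₁ E₂ {x} x∈ rewrite path-mul E₁ E₂ x | proj₂ (path-∈ E₁ x∈) = refl

pathOf-mulʳ : ∀ E₁ E₂ {x} → x ∉ vars E₁ → pathOf (mul E₁ E₂) x ≡ pathOf E₂ x
pathOf-mulʳ E₁ E₂ {x} x∉ rewrite path-mul E₁ E₂ x | path-∉ E₁ x∉ = refl

pathOf-lin-root : ∀ E z c → pathOf (lin E z c) z ≡ [ z ]
pathOf-lin-root E z c with z ≟ z
... | yes _   = refl
... | no z≢z  = ⊥-elim (z≢z refl)

pathOf-lin : ∀ E z c {x} → ¬ x ≡ z → x ∈ vars E → pathOf (lin E z c) x ≡ z ∷ pathOf E x
pathOf-lin E z c {x} x≢z x∈ with x ≟ z
... | yes x≡z = ⊥-elim (x≢z x≡z)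
... | no _ rewrite proj₂ (path-∈ E x∈) = refl

descendantsOf-mulˡ : ∀ E₁ E₂ {x} → x ∈ vars E₁ → descendantsOf (mul E₁ E₂) x ≡ descendantsOf E₁ x
descendantsOf-mulˡ E₁ E₂ {x} x∈ rewrite descendants-mul E₁ E₂ x | proj₂ (descendants-∈ E₁ x∈) = refl

descendantsOf-mulʳ : ∀ E₁ E₂ {x} → x ∉ vars E₁ → descendantsOf (mul E₁ E₂) x ≡ descendantsOf E₂ x
descendantsOf-mulʳ E₁ E₂ {x} x∉ rewrite descendants-mul E₁ E₂ x | descendants-∉ E₁ x∉ = refl

descendantsOf-lin-root : ∀ E z c → descendantsOf (lin E z c) z ≡ z ∷ treeVars (tree E)
descendantsOf-lin-root E z c with z ≟ z
... | yes _   = refl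
... | no z≢z  = ⊥-elim (z≢z refl)

descendantsOf-lin : ∀ E z c {x} → ¬ x ≡ z → descendantsOf (lin E z c) x ≡ descendantsOf E x
descendantsOf-lin E z c {x} x≢z with x ≟ z
... | yes x≡z = ⊥-elim (x≢z x≡z)
... | no _ with descendants x (tree E)
...   | just _  = refl
...   | nothing = refl

-- Ancestor E y x : the vertex v_y is v_x or one of its ancestors.
data Ancestor : Expr → Var → Var → Set where
  anc-root : ∀ {E z c x}    → x ∈ vars (lin E z c) → Ancestor (lin E z c) z x
  anc-lin  : ∀ {E z c x y}  → Ancestor E y x → Ancestor (lin E z c) y x
  anc-mulˡ : ∀ {E₁ E₂ x y}  → Ancestor E₁ y x → Ancestor (mul E₁ E₂) y x
  anc-mulʳ : ∀ {E₁ E₂ x y}  → Ancestor E₂ y x → Ancestor (mul E₁ E₂) y x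

ancestor-∈ : ∀ {E y x} → Ancestor E y x → y ∈ vars E
ancestor-∈ {lin E z c} (anc-root _) = lin-var E z c
ancestor-∈ (anc-lin a)              = ∈-++⁺ˡ (ancestor-∈ a)
ancestor-∈ (anc-mulˡ a)             = ∈-++⁺ˡ (ancestor-∈ a)
ancestor-∈ {mul E₁ E₂} (anc-mulʳ a) = ∈-++⁺ʳ (vars E₁) (ancestor-∈ a)

descendant-∈ : ∀ {E y x} → Ancestor E y x → x ∈ vars E
descendant-∈ (anc-root x∈)            = x∈
descendant-∈ (anc-lin a)              = ∈-++⁺ˡ (descendant-∈ a)
descendant-∈ (anc-mulˡ a)             = ∈-++⁺ˡ (descendant-∈ a)
descendant-∈ {mul E₁ E₂} (anc-mulʳ a) = ∈-++⁺ʳ (vars E₁) (descendant-∈ a)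

ancestor-refl : ∀ E {x} → x ∈ vars E → Ancestor E x x
ancestor-refl (const n) ()
ancestor-refl (mul E₁ E₂) x∈ with ∈-++⁻ (vars E₁) x∈
... | inj₁ x∈₁ = anc-mulˡ (ancestor-refl E₁ x∈₁)
... | inj₂ x∈₂ = anc-mulʳ (ancestor-refl E₂ x∈₂)
ancestor-refl (lin E z c) {x} x∈ with x ≟ z
... | yes refl = anc-root x∈
... | no x≢z   = anc-lin (ancestor-refl E (∈-∷ʳ-≢ (vars E) x∈ x≢z))

ancestor-trans : ∀ {E u y x} → LowDefect E → Ancestor E u y → Ancestor E y x → Ancestor E u x
ancestor-trans _                    (anc-root _)  a₂            = anc-root (descendant-∈ a₂)
ancestor-trans (ld-lin _ z∉ _)      (anc-lin a₁)  (anc-root _)  = ⊥-elim (z∉ (descendant-∈ a₁))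
ancestor-trans (ld-lin ld _ _)      (anc-lin a₁)  (anc-lin a₂)  = anc-lin (ancestor-trans ld a₁ a₂)
ancestor-trans (ld-mul ld₁ _ _)     (anc-mulˡ a₁) (anc-mulˡ a₂) = anc-mulˡ (ancestor-trans ld₁ a₁ a₂)
ancestor-trans (ld-mul _ _ disj)    (anc-mulˡ a₁) (anc-mulʳ a₂) = ⊥-elim (disj _ (descendant-∈ a₁) (ancestor-∈ a₂))
ancestor-trans (ld-mul _ _ disj)    (anc-mulʳ a₁) (anc-mulˡ a₂) = ⊥-elim (disj _ (ancestor-∈ a₂) (descendant-∈ a₁))
ancestor-trans (ld-mul _ ld₂ _)     (anc-mulʳ a₁) (anc-mulʳ a₂) = anc-mulʳ (ancestor-trans ld₂ a₁ a₂)

-- Nesting is ancestry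

⊑-vars : ∀ {S E} → S ⊑ E → vars S ⊆ vars E
⊑-vars ⊑-refl       v∈ = v∈
⊑-vars (⊑-mulˡ s)   v∈ = ∈-++⁺ˡ (⊑-vars s v∈)
⊑-vars {E = mul E₁ E₂} (⊑-mulʳ s) v∈ = ∈-++⁺ʳ (vars E₁) (⊑-vars s v∈)
⊑-vars (⊑-lin s)    v∈ = ∈-++⁺ˡ (⊑-vars s v∈)

smallest-root : ∀ {E z c} → z ∉ vars E → Smallest (lin E z c) z (lin E z c)
smallest-root {E} {z} {c} z∉ = ⊑-refl , lin-var E z c , least
  where
  least : ∀ S′ → S′ ⊑ lin E z c → z ∈ vars S′ → lin E z c ⊑ S′
  least _ ⊑-refl    _  = ⊑-refl
  least _ (⊑-lin s) z∈ = ⊥-elim (z∉ (⊑-vars s z∈))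

smallest-lin⁺ : ∀ {S y E z c} → Smallest S y E → Smallest S y (lin E z c)
smallest-lin⁺ (S⊑ , y∈ , least) = ⊑-lin S⊑ , y∈ , λ where
  _ ⊑-refl    _  → ⊑-lin S⊑
  _ (⊑-lin s) y∈ → least _ s y∈

smallest-mulˡ⁺ : ∀ {S y E₁ E₂} → y ∉ vars E₂ → Smallest S y E₁ → Smallest S y (mul E₁ E₂)
smallest-mulˡ⁺ y∉ (S⊑ , y∈ , least) = ⊑-mulˡ S⊑ , y∈ , λ where
  _ ⊑-refl     _   → ⊑-mulˡ S⊑
  _ (⊑-mulˡ s) y∈′ → least _ s y∈′
  _ (⊑-mulʳ s) y∈′ → ⊥-elim (y∉ (⊑-vars s y∈′))

smallest-mulʳ⁺ : ∀ {S y E₁ E₂} → y ∉ vars E₁ → Smallest S y E₂ → Smallest S y (mul E₁ E₂)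
smallest-mulʳ⁺ y∉ (S⊑ , y∈ , least) = ⊑-mulʳ S⊑ , y∈ , λ where
  _ ⊑-refl     _   → ⊑-mulʳ S⊑
  _ (⊑-mulˡ s) y∈′ → ⊥-elim (y∉ (⊑-vars s y∈′))
  _ (⊑-mulʳ s) y∈′ → least _ s y∈′

smallest-lin⁻ : ∀ {S y E z c} → y ∈ vars E → Smallest S y (lin E z c) → Smallest S y E
smallest-lin⁻ {E = E} y∈E (_ , y∈ , least) =
  least E (⊑-lin ⊑-refl) y∈E , y∈ , λ S′ s → least S′ (⊑-lin s)

smallest-mulˡ⁻ : ∀ {S y E₁ E₂} → y ∈ vars E₁ → Smallest S y (mul E₁ E₂) → Smallest S y E₁
smallest-mulˡ⁻ {E₁ = E₁} y∈₁ (_ , y∈ , least) =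
  least E₁ (⊑-mulˡ ⊑-refl) y∈₁ , y∈ , λ S′ s → least S′ (⊑-mulˡ s)

smallest-mulʳ⁻ : ∀ {S y E₁ E₂} → y ∈ vars E₂ → Smallest S y (mul E₁ E₂) → Smallest S y E₂
smallest-mulʳ⁻ {E₂ = E₂} y∈₂ (_ , y∈ , least) =
  least E₂ (⊑-mulʳ ⊑-refl) y∈₂ , y∈ , λ S′ s → least S′ (⊑-mulʳ s)

smallest⇒ancestor : ∀ E {S y x} → Smallest S y E → x ∈ vars S → Ancestor E y x
smallest⇒ancestor (const n) (S⊑ , y∈ , _) _ with ⊑-vars S⊑ y∈
... | ()
smallest⇒ancestor (mul E₁ E₂) sm@(S⊑ , y∈ , _) x∈ with ∈-++⁻ (vars E₁) (⊑-vars S⊑ y∈)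
... | inj₁ y∈₁ = anc-mulˡ (smallest⇒ancestor E₁ (smallest-mulˡ⁻ y∈₁ sm) x∈)
... | inj₂ y∈₂ = anc-mulʳ (smallest⇒ancestor E₂ (smallest-mulʳ⁻ y∈₂ sm) x∈)
smallest⇒ancestor (lin E z c) {y = y} sm@(S⊑ , y∈ , _) x∈ with y ≟ z
... | yes refl = anc-root (⊑-vars S⊑ x∈)
... | no y≢z   = anc-lin (smallest⇒ancestor E (smallest-lin⁻ (∈-∷ʳ-≢ (vars E) (⊑-vars S⊑ y∈) y≢z) sm) x∈)

ancestor⇒nesting : ∀ {E y x} → LowDefect E → Ancestor E y x → x ⪯[ E ] y
ancestor⇒nesting {lin E z c} (ld-lin _ z∉ _) (anc-root x∈) = lin E z c , smallest-root z∉ , x∈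
ancestor⇒nesting (ld-lin ld _ _) (anc-lin a) with ancestor⇒nesting ld a
... | S , sm , x∈ = S , smallest-lin⁺ sm , x∈
ancestor⇒nesting (ld-mul ld₁ _ disj) (anc-mulˡ a) with ancestor⇒nesting ld₁ a
... | S , sm , x∈ = S , smallest-mulˡ⁺ (disj _ (ancestor-∈ a)) sm , x∈
ancestor⇒nesting (ld-mul _ ld₂ disj) (anc-mulʳ a) with ancestor⇒nesting ld₂ a
... | S , sm , x∈ = S , smallest-mulʳ⁺ (λ y∈₁ → disj _ y∈₁ (ancestor-∈ a)) sm , x∈

nesting⇔ancestor : ∀ {E} → LowDefect E → ∀ x y → (x ⪯[ E ] y) ⇔ Ancestor E y x
nesting⇔ancestor {E} ld x y =
  mk⇔ (λ { (_ , sm , x∈) → smallest⇒ancestor E sm x∈ }) (ancestor⇒nesting ld)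

-- Keys are root-to-vertex paths

∈-pathOf⇒ancestor : ∀ E {x v} → x ∈ vars E → v ∈ pathOf E x → Ancestor E v x
∈-pathOf⇒ancestor (const n) () _
∈-pathOf⇒ancestor (mul E₁ E₂) {x} x∈ v∈ with x ∈? vars E₁
... | yes x∈₁ rewrite pathOf-mulˡ E₁ E₂ x∈₁ = anc-mulˡ (∈-pathOf⇒ancestor E₁ x∈₁ v∈)
... | no x∉₁ rewrite pathOf-mulʳ E₁ E₂ x∉₁ = anc-mulʳ (∈-pathOf⇒ancestor E₂ (∈-++-∉ˡ (vars E₁) x∈ x∉₁) v∈)
∈-pathOf⇒ancestor (lin E z c) {x} x∈ = byRoot (x ≟ z)
  where
  byRoot : ∀ {v} → Dec (x ≡ z) → v ∈ pathOf (lin E z c) x → Ancestor (lin E z c) v x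
  byRoot (yes refl) rewrite pathOf-lin-root E x c = λ { (here refl) → anc-root x∈ }
  byRoot (no x≢z) rewrite pathOf-lin E z c x≢z (∈-∷ʳ-≢ (vars E) x∈ x≢z) = λ where
    (here refl)  → anc-root x∈
    (there v∈′) → anc-lin (∈-pathOf⇒ancestor E (∈-∷ʳ-≢ (vars E) x∈ x≢z) v∈′)

∈-pathOf-self : ∀ E {x} → x ∈ vars E → x ∈ pathOf E x
∈-pathOf-self (const n) ()
∈-pathOf-self (mul E₁ E₂) {x} x∈ with x ∈? vars E₁
... | yes x∈₁ rewrite pathOf-mulˡ E₁ E₂ x∈₁ = ∈-pathOf-self E₁ x∈₁
... | no x∉₁ rewrite pathOf-mulʳ E₁ E₂ x∉₁ = ∈-pathOf-self E₂ (∈-++-∉ˡ (vars E₁) x∈ x∉₁)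
∈-pathOf-self (lin E z c) {x} x∈ = byRoot (x ≟ z)
  where
  byRoot : Dec (x ≡ z) → x ∈ pathOf (lin E z c) x
  byRoot (yes refl) rewrite pathOf-lin-root E x c = here refl
  byRoot (no x≢z) rewrite pathOf-lin E z c x≢z (∈-∷ʳ-≢ (vars E) x∈ x≢z) = there (∈-pathOf-self E (∈-∷ʳ-≢ (vars E) x∈ x≢z))

ancestor⇒pathOf-prefix : ∀ {E y x} → LowDefect E → Ancestor E y x → ∃ λ q → pathOf E x ≡ pathOf E y ++ q
ancestor⇒pathOf-prefix {lin E z c} {x = x} _ (anc-root x∈) = byRoot (x ≟ z)
  where
  byRoot : Dec (x ≡ z) → ∃ λ q → pathOf (lin E z c) x ≡ pathOf (lin E z c) z ++ q
  byRoot (yes refl) = [] , sym (++-identityʳ (pathOf (lin E x c) x))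
  byRoot (no x≢z) rewrite pathOf-lin E z c x≢z (∈-∷ʳ-≢ (vars E) x∈ x≢z) | pathOf-lin-root E z c = pathOf E x , refl
ancestor⇒pathOf-prefix {lin E z c} (ld-lin ld z∉ _) (anc-lin a)
  rewrite pathOf-lin E z c (λ { refl → z∉ (descendant-∈ a) }) (descendant-∈ a)
        | pathOf-lin E z c (λ { refl → z∉ (ancestor-∈ a) }) (ancestor-∈ a)
  with ancestor⇒pathOf-prefix ld a
... | q , eq = q , cong (z ∷_) eq
ancestor⇒pathOf-prefix {mul E₁ E₂} (ld-mul ld₁ _ _) (anc-mulˡ a)
  rewrite pathOf-mulˡ E₁ E₂ (descendant-∈ a) | pathOf-mulˡ E₁ E₂ (ancestor-∈ a) = ancestor⇒pathOf-prefix ld₁ a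
ancestor⇒pathOf-prefix {mul E₁ E₂} (ld-mul _ ld₂ disj) (anc-mulʳ a)
  rewrite pathOf-mulʳ E₁ E₂ (λ x∈₁ → disj _ x∈₁ (descendant-∈ a))
        | pathOf-mulʳ E₁ E₂ (λ y∈₁ → disj _ y∈₁ (ancestor-∈ a)) = ancestor⇒pathOf-prefix ld₂ a

key-∣ₘ⇔ancestor : ∀ {E} → LowDefect E → ∀ {x y} → x ∈ vars E → y ∈ vars E →
                  (key E y ∣ₘ key E x) ⇔ Ancestor E y x
key-∣ₘ⇔ancestor {E} ld {x} {y} x∈ y∈ = mk⇔ to from
  where
  to : key E y ∣ₘ key E x → Ancestor E y x
  to y∣x = ∈-pathOf⇒ancestor E x∈ (∣ₘ⇒⊆ (pathOf E y) (pathOf E x) y∣x (∈-pathOf-self E y∈))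

  from : Ancestor E y x → key E y ∣ₘ key E x
  from a with ancestor⇒pathOf-prefix ld a
  ... | q , eq rewrite eq = monomial-++ˡ (pathOf E y) q

-- Anti-keys are complements of subtrees

∈-descendantsOf⇒ancestor : ∀ E {y x} → x ∈ descendantsOf E y → Ancestor E y x
∈-descendantsOf⇒ancestor (const n) ()
∈-descendantsOf⇒ancestor (mul E₁ E₂) {y} x∈ with y ∈? vars E₁
... | yes y∈₁ rewrite descendantsOf-mulˡ E₁ E₂ y∈₁ = anc-mulˡ (∈-descendantsOf⇒ancestor E₁ x∈)
... | no y∉₁ rewrite descendantsOf-mulʳ E₁ E₂ y∉₁ = anc-mulʳ (∈-descendantsOf⇒ancestor E₂ x∈)
∈-descendantsOf⇒ancestor (lin E z c) {y} = byRoot (y ≟ z)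
  where
  byRoot : ∀ {x} → Dec (y ≡ z) → x ∈ descendantsOf (lin E z c) y → Ancestor (lin E z c) y x
  byRoot (no y≢z) rewrite descendantsOf-lin E z c y≢z = λ x∈ → anc-lin (∈-descendantsOf⇒ancestor E x∈)
  byRoot (yes refl) rewrite descendantsOf-lin-root E y c = λ where
    (here refl)  → anc-root (lin-var E y c)
    (there x∈′) → anc-root (∈-++⁺ˡ (treeVars⊆vars E x∈′))

ancestor⇒∈-descendantsOf : ∀ {E y x} → LowDefect E → Ancestor E y x → x ∈ descendantsOf E y
ancestor⇒∈-descendantsOf {lin E z c} _ (anc-root x∈) rewrite descendantsOf-lin-root E z c with ∈-++⁻ (vars E) x∈
... | inj₁ x∈E        = there (vars⊆treeVars E x∈E)
... | inj₂ (here refl) = here refl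
ancestor⇒∈-descendantsOf {lin E z c} {y} (ld-lin ld z∉ _) (anc-lin a)
  rewrite descendantsOf-lin E z c {y} (λ { refl → z∉ (ancestor-∈ a) }) = ancestor⇒∈-descendantsOf ld a
ancestor⇒∈-descendantsOf {mul E₁ E₂} (ld-mul ld₁ _ _) (anc-mulˡ a)
  rewrite descendantsOf-mulˡ E₁ E₂ (ancestor-∈ a) = ancestor⇒∈-descendantsOf ld₁ a
ancestor⇒∈-descendantsOf {mul E₁ E₂} (ld-mul _ ld₂ disj) (anc-mulʳ a)
  rewrite descendantsOf-mulʳ E₁ E₂ (λ y∈₁ → disj _ y∈₁ (ancestor-∈ a)) = ancestor⇒∈-descendantsOf ld₂ a

antiKey-∣ₘ⇔ancestor : ∀ {E} → LowDefect E → ∀ {x y} → x ∈ vars E →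
                      (antiKey E y ∣ₘ antiKey E x) ⇔ Ancestor E y x
antiKey-∣ₘ⇔ancestor {E} ld {x} {y} x∈ = mk⇔ to from
  where
  outside : ∀ u w → Dec (¬ w ∈ descendantsOf E u)
  outside u w = ¬? (w ∈? descendantsOf E u)

  -- Outside the subtree of v_y, the vertex v_x would occur in the anti-key of y but not in that of x.
  to : antiKey E y ∣ₘ antiKey E x → Ancestor E y x
  to y∣x with x ∈? descendantsOf E y
  ... | yes x∈Dy = ∈-descendantsOf⇒ancestor E x∈Dy
  ... | no x∉Dy  = ⊥-elim (proj₂ (∈-filter⁻ (outside x) {xs = treeVars (tree E)} x∈antiKeyx)
                                  (ancestor⇒∈-descendantsOf ld (ancestor-refl E x∈)))
    where
    x∈antiKeyy : x ∈ filter (outside y) (treeVars (tree E))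
    x∈antiKeyy = ∈-filter⁺ (outside y) (vars⊆treeVars E x∈) x∉Dy

    x∈antiKeyx : x ∈ filter (outside x) (treeVars (tree E))
    x∈antiKeyx = ∣ₘ⇒⊆ _ _ y∣x x∈antiKeyy

  from : Ancestor E y x → antiKey E y ∣ₘ antiKey E x
  from a = monomial-filter-mono (outside y) (outside x)
    (λ w∉Dy w∈Dx → w∉Dy (ancestor⇒∈-descendantsOf ld
                          (ancestor-trans ld a (∈-descendantsOf⇒ancestor E w∈Dx))))
    (treeVars (tree E))

proposition3p18 : (E : Expr) → LowDefect E → (x y : Var) → x ∈ vars E → y ∈ vars E →
    ((x ⪯[ E ] y) ⇔ (key E y ∣ₘ key E x)) × ((key E y ∣ₘ key E x) ⇔ (antiKey E y ∣ₘ antiKey E x))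
proposition3p18 E ld x y x∈ y∈ =
  ⇔.trans (nesting⇔ancestor ld x y) (⇔.sym key⇔ancestor) , ⇔.trans key⇔ancestor (⇔.sym (antiKey-∣ₘ⇔ancestor ld x∈))
  where
  key⇔ancestor : (key E y ∣ₘ key E x) ⇔ Ancestor E y x
  key⇔ancestor = key-∣ₘ⇔ancestor ld x∈ y∈
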